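{- For every $\gamma>0$ and all positive integers $k,m$, $z_k(\gamma)\le z_{k\cdot m}(\gamma)$.
   Context: For an integer $k\ge1$ and $\gamma>0$, $z_k(\gamma)$ is the optimal value (supremum) of the program: maximize $\frac{(1+\gamma)\sum_{i=0}^{k-1}(s_i-a_i)}{F+\sum_{i=0}^{k-1}(d_i+|a_i|)}$ over real variables $F\ge0$ and $d_i,a_i,s_i$ ($0\le i<k$), subject to: $s_i\le s_{i+1}$ for $0\le i<k-1$; $(\gamma-1)s_i-\gamma a_i\le d_i+d_j+(\gamma-1)s_j-\gamma a_j$ for all $0\le j<i<k$; $\sum_{i=\ell}^{k-1}\max\{\gamma(s_\ell-a_i)-d_i,0\}\le F$ for all $0\le\ell<k$; $d_i\ge0$ and $s_i\ge a_i$ for all $0\le i<k$. -}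

module Defs where

open import Level using (0ℓ)
open import Data.Nat as ℕ using (ℕ; zero; suc)
open import Data.Fin using (Fin; zero; suc; toℕ)
open import Data.Product using (Σ; ∃; _×_; _,_)
open import Data.Sum using (_⊎_)
open import Relation.Nullary using (¬_; yes; no)
open import Relation.Binary.PropositionalEquality using (_≡_; _≢_)
open import Relation.Binary.Definitions using (tri<; tri≈; tri>)
import Algebra.Structures as AS
import Relation.Binary.Structures as RS

-- Every model is isomorphic to ℝ.
-- The multiplicative inverse is made total with the convention 0⁻¹ = 0.
record RealField : Set₁ where
  infixl 6 _+_ _-_
  infixl 7 _*_
  infix  4 _<_ _≤_
  field
    ℝ    : Set
    0# 1# : ℝ
    _+_ _*_ : ℝ → ℝ → ℝ
    -_   : ℝ → ℝ
    _⁻¹  : ℝ → ℝ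
    _<_  : ℝ → ℝ → Set
    isCommutativeRing : AS.IsCommutativeRing {A = ℝ} _≡_ _+_ _*_ -_ 0# 1#
    0≢1       : 0# ≢ 1#
    *-inverse : ∀ x → x ≢ 0# → x * (x ⁻¹) ≡ 1#
    0⁻¹≡0     : 0# ⁻¹ ≡ 0#
    isStrictTotalOrder : RS.IsStrictTotalOrder {A = ℝ} _≡_ _<_
    +-mono-<  : ∀ x y z → x < y → x + z < y + z
    *-pos     : ∀ x y → 0# < x → 0# < y → 0# < x * y

  _≤_ : ℝ → ℝ → Set
  x ≤ y = x < y ⊎ x ≡ y

  _-_ : ℝ → ℝ → ℝ
  x - y = x + (- y)

  field
    complete : (P : ℝ → Set) → ∃ P → (∃ λ b → ∀ x → P x → x ≤ b) →
               ∃ λ u → (∀ x → P x → x ≤ u) × (∀ b → (∀ x → P x → x ≤ b) → u ≤ b)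

-- The program defining z_k(γ), over a model R of the reals.
module Program (R : RealField) where
  open RealField R

  max : ℝ → ℝ → ℝ
  max x y with RS.IsStrictTotalOrder.compare isStrictTotalOrder x y
  ... | tri< _ _ _ = y
  ... | tri≈ _ _ _ = x
  ... | tri> _ _ _ = x

  ∣_∣ : ℝ → ℝ
  ∣ x ∣ = max x (- x)

  sum : (n : ℕ) → (Fin n → ℝ) → ℝ
  sum zero    f = 0#
  sum (suc n) f = f zero + sum n (λ i → f (suc i))

  sumFrom : {n : ℕ} → Fin n → (Fin n → ℝ) → ℝ
  sumFrom {n} ℓ f = sum n (λ i → g i (toℕ ℓ ℕ.≤? toℕ i))
    where
    open import Relation.Nullary using (Dec)
    g : (i : Fin n) → Dec (toℕ ℓ ℕ.≤ toℕ i) → ℝ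
    g i (yes _) = f i
    g i (no _)  = 0#

  record Point (k : ℕ) : Set where
    constructor point
    field
      F : ℝ
      d a s : Fin k → ℝ

  record Feasible (γ : ℝ) {k : ℕ} (p : Point k) : Set where
    open Point p
    field
      s-mono : ∀ (i j : Fin k) → toℕ j ≡ suc (toℕ i) → s i ≤ s j
      pair   : ∀ (i j : Fin k) → toℕ j ℕ.< toℕ i →
               (γ - 1#) * s i - γ * a i ≤ d i + d j + (γ - 1#) * s j - γ * a j
      F-bound : ∀ (ℓ : Fin k) →
               sumFrom ℓ (λ i → max (γ * (s ℓ - a i) - d i) 0#) ≤ F
      F-nonneg : 0# ≤ F
      d-nonneg : ∀ i → 0# ≤ d i
      s≥a      : ∀ i → a i ≤ s i

  numerator : ℝ → {k : ℕ} → Point k → ℝ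
  numerator γ {k} p = (1# + γ) * sum k (λ i → s i - a i)
    where open Point p

  denominator : {k : ℕ} → Point k → ℝ
  denominator {k} p = F + sum k (λ i → d i + ∣ a i ∣)
    where open Point p

  objective : ℝ → {k : ℕ} → Point k → ℝ
  objective γ p = numerator γ p * (denominator p ⁻¹)

  -- admissible points: feasible with a well-defined (positive-denominator) ratio
  Admissible : ℝ → (k : ℕ) → Point k → Set
  Admissible γ k p = Feasible γ p × (0# < denominator p)

  -- z_k(γ) ≤ z_n(γ), for the suprema (in the extended reals) of the objective
  -- over admissible points: every value attained in the k-program is
  -- approximated arbitrarily well from above-minus-ε in the n-program.
  zLe : ℝ → ℕ → ℕ → Set
  zLe γ k n = ∀ (p : Point k) → Admissible γ k p → ∀ (ε : ℝ) → 0# < ε →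
              ∃ λ (q : Point n) → Admissible γ n q × (objective γ p - ε < objective γ q)

{-# OPTIONS --safe #-}
-- Repeat every index of a feasible point of the k-program m times, in
-- consecutive blocks, and scale F by m.  Constraints between two copies of
-- the same index only ask d ≥ 0, the tail sums defining F grow at most by the
-- factor m, and numerator and denominator both get multiplied by m, so the
-- objective value is attained exactly in the (k·m)-program.
module Submission where

open import Defs
open import Level using (0ℓ)
open import Algebra.Bundles using (CommutativeRing)
import Algebra.Structures as AS
open import Relation.Binary.Bundles using (StrictPartialOrder)
import Relation.Binary.Structures as RS
import Relation.Binary.Construct.StrictToNonStrict as NonStrict
open import Relation.Binary.Definitions using (tri<; tri≈; tri>)
open import Relation.Binary.PropositionalEquality
open import Relation.Nullary using (¬_; Dec; yes; no; contradiction)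
open import Data.Nat as ℕ using (ℕ; zero; suc)
import Data.Nat.Properties as ℕₚ
open import Data.Fin as Fin using (Fin; zero; suc; toℕ; inject₁; _↑ˡ_; _↑ʳ_; combine; quotient; remainder)
open import Data.Fin.Properties
  using (toℕ-injective; toℕ-inject₁; remQuot-combine; combine-remQuot; combine-monoˡ-<; ≤∧≢⇒<)
open import Data.Product using (_,_; proj₁; proj₂)
open import Data.Sum using (inj₁; inj₂)
open import Function using (_∘_)

quotient-mono : ∀ {k} m {i j : Fin (k ℕ.* m)} → i Fin.≤ j → quotient {k} m i Fin.≤ quotient {k} m j
quotient-mono {k} m {i} {j} i≤j = ℕₚ.≮⇒≥ qj≮qi
  where
  qj≮qi : ¬ quotient {k} m j Fin.< quotient {k} m i
  qj≮qi qj<qi = ℕₚ.≤⇒≯ i≤j (subst₂ Fin._<_ (combine-remQuot {k} m j) (combine-remQuot {k} m i)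
                  (combine-monoˡ-< (remainder {k} m j) (remainder {k} m i) qj<qi))

module OrderedFieldProperties (R : RealField) where
  open RealField R
  open Program R using (max)
  open AS.IsCommutativeRing isCommutativeRing
    using (+-assoc; +-comm; +-identityˡ; +-identityʳ; -‿inverseˡ; -‿inverseʳ;
           *-assoc; *-comm; *-identityʳ; distribˡ; distribʳ; zeroˡ; zeroʳ)
  open RS.IsStrictTotalOrder isStrictTotalOrder
    using (compare; irrefl; <-respʳ-≈; isStrictPartialOrder) renaming (trans to <-trans)

  commutativeRing : CommutativeRing 0ℓ 0ℓ
  commutativeRing = record { isCommutativeRing = isCommutativeRing }

  open CommutativeRing commutativeRing using (ring; *-commutativeSemigroup)
  open import Algebra.Properties.Ring ring using (-1*x≈-x; -‿involutive)
  open import Algebra.Properties.CommutativeSemigroup *-commutativeSemigroup using (x∙yz≈y∙xz)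

  strictPartialOrder : StrictPartialOrder 0ℓ 0ℓ 0ℓ
  strictPartialOrder = record { isStrictPartialOrder = isStrictPartialOrder }

  open import Relation.Binary.Reasoning.StrictPartialOrder strictPartialOrder public

  ≤-refl : ∀ {x} → x ≤ x
  ≤-refl = inj₂ refl

  ≤-trans : ∀ {x y z} → x ≤ y → y ≤ z → x ≤ z
  ≤-trans = RS.IsTotalOrder.trans (NonStrict.isTotalOrder _≡_ _<_ isStrictTotalOrder)

  <-≤-trans : ∀ {x y z} → x < y → y ≤ z → x < z
  <-≤-trans = NonStrict.<-≤-trans _≡_ _<_ <-trans <-respʳ-≈

  +-monoˡ-< : ∀ z {x y} → x < y → x + z < y + z
  +-monoˡ-< z = +-mono-< _ _ z

  +-monoʳ-< : ∀ z {x y} → x < y → z + x < z + y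
  +-monoʳ-< z {x} {y} x<y = subst₂ _<_ (+-comm x z) (+-comm y z) (+-monoˡ-< z x<y)

  +-monoˡ-≤ : ∀ z {x y} → x ≤ y → x + z ≤ y + z
  +-monoˡ-≤ z (inj₁ x<y) = inj₁ (+-monoˡ-< z x<y)
  +-monoˡ-≤ z (inj₂ refl) = ≤-refl

  +-monoʳ-≤ : ∀ z {x y} → x ≤ y → z + x ≤ z + y
  +-monoʳ-≤ z (inj₁ x<y) = inj₁ (+-monoʳ-< z x<y)
  +-monoʳ-≤ z (inj₂ refl) = ≤-refl

  +-mono-≤ : ∀ {x y u v} → x ≤ y → u ≤ v → x + u ≤ y + v
  +-mono-≤ {y = y} {u} x≤y u≤v = ≤-trans (+-monoˡ-≤ u x≤y) (+-monoʳ-≤ y u≤v)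

  x≤y+x : ∀ {y} x → 0# ≤ y → x ≤ y + x
  x≤y+x {y} x 0≤y = subst (_≤ y + x) (+-identityˡ x) (+-monoˡ-≤ x 0≤y)

  x+y-nonneg : ∀ {x y} → 0# ≤ x → 0# ≤ y → 0# ≤ x + y
  x+y-nonneg {x} 0≤x 0≤y = ≤-trans 0≤x (subst (_≤ x + _) (+-identityʳ x) (+-monoʳ-≤ x 0≤y))

  x-y<x : ∀ x {y} → 0# < y → x - y < x
  x-y<x x {y} 0<y = subst (x - y <_) (+-identityʳ x) (+-monoʳ-< x -y<0)
    where
    -y<0 : - y < 0#
    -y<0 = subst₂ _<_ (+-identityˡ (- y)) (-‿inverseʳ y) (+-monoˡ-< (- y) 0<y)

  0<1 : 0# < 1#
  0<1 with compare 0# 1#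
  ... | tri< 0<1 _ _ = 0<1
  ... | tri≈ _ 0≡1 _ = contradiction 0≡1 0≢1
  ... | tri> _ _ 1<0 = contradiction (<-trans 1<0 0<[-1]*[-1]) (irrefl (sym (trans (-1*x≈-x (- 1#)) (-‿involutive 1#))))
    where
    0<-1 : 0# < - 1#
    0<-1 = subst₂ _<_ (-‿inverseʳ 1#) (+-identityˡ (- 1#)) (+-monoˡ-< (- 1#) 1<0)
    0<[-1]*[-1] : 0# < - 1# * - 1#
    0<[-1]*[-1] = *-pos _ _ 0<-1 0<-1

  x*y-nonneg : ∀ {x y} → 0# ≤ x → 0# ≤ y → 0# ≤ x * y
  x*y-nonneg (inj₁ 0<x) (inj₁ 0<y) = inj₁ (*-pos _ _ 0<x 0<y)
  x*y-nonneg {x} (inj₁ _) (inj₂ refl) = inj₂ (sym (zeroʳ x))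
  x*y-nonneg {y = y} (inj₂ refl) _ = inj₂ (sym (zeroˡ y))

  *-monoˡ-≤ : ∀ {z} x y → 0# ≤ z → x ≤ y → z * x ≤ z * y
  *-monoˡ-≤ {z} x y 0≤z x≤y = begin
    z * x             ≤⟨ x≤y+x (z * x) (x*y-nonneg 0≤z 0≤y-x) ⟩
    z * (y - x) + z * x ≡⟨ distribˡ z (y - x) x ⟨
    z * (y - x + x)   ≡⟨ cong (z *_) y-x+x≡y ⟩
    z * y             ∎
    where
    0≤y-x : 0# ≤ y - x
    0≤y-x = subst (_≤ y - x) (-‿inverseʳ x) (+-monoˡ-≤ (- x) x≤y)
    y-x+x≡y : y - x + x ≡ y
    y-x+x≡y = trans (+-assoc y (- x) x) (trans (cong (y +_) (-‿inverseˡ x)) (+-identityʳ y))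

  y≤max[x,y] : ∀ x y → y ≤ max x y
  y≤max[x,y] x y with compare x y
  ... | tri< _ _ _ = ≤-refl
  ... | tri≈ _ x≡y _ = inj₂ (sym x≡y)
  ... | tri> _ _ y<x = inj₁ y<x

  mono-by-steps : ∀ {n} (f : Fin n → ℝ) → (∀ i j → toℕ j ≡ suc (toℕ i) → f i ≤ f j) →
    ∀ δ i j → toℕ j ≡ toℕ i ℕ.+ δ → f i ≤ f j
  mono-by-steps f step zero i j j≡i+0 =
    inj₂ (cong f (toℕ-injective (trans (sym (ℕₚ.+-identityʳ (toℕ i))) (sym j≡i+0))))
  mono-by-steps f step (suc δ) i zero 0≡i+1+δ = contradiction (trans 0≡i+1+δ (ℕₚ.+-suc (toℕ i) δ)) ℕₚ.0≢1+n
  mono-by-steps f step (suc δ) i (suc j) 1+j≡i+1+δ = ≤-trans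
    (mono-by-steps f step δ i (inject₁ j) (trans (toℕ-inject₁ j) (ℕₚ.suc-injective (trans 1+j≡i+1+δ (ℕₚ.+-suc (toℕ i) δ)))))
    (step (inject₁ j) (suc j) (cong suc (sym (toℕ-inject₁ j))))

  mono-from-steps : ∀ {n} (f : Fin n → ℝ) → (∀ i j → toℕ j ≡ suc (toℕ i) → f i ≤ f j) →
    ∀ {i j} → i Fin.≤ j → f i ≤ f j
  mono-from-steps f step i≤j = mono-by-steps f step _ _ _ (sym (ℕₚ.m+[n∸m]≡n i≤j))

  0<x⇒x≢0 : ∀ {x} → 0# < x → x ≢ 0#
  0<x⇒x≢0 0<x x≡0 = irrefl (sym x≡0) 0<x

  *-cancelˡ-ratio : ∀ {c y} x → 0# < c → 0# < y → (c * x) * (c * y) ⁻¹ ≡ x * y ⁻¹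
  *-cancelˡ-ratio {c} {y} x 0<c 0<y = begin-equality
    (c * x) * w        ≡⟨ cong (λ t → (c * t) * w) r*y≡x ⟨
    (c * (r * y)) * w  ≡⟨ cong (_* w) (x∙yz≈y∙xz c r y) ⟩
    (r * (c * y)) * w  ≡⟨ *-assoc r (c * y) w ⟩
    r * ((c * y) * w)  ≡⟨ cong (r *_) (*-inverse (c * y) (0<x⇒x≢0 (*-pos c y 0<c 0<y))) ⟩
    r * 1#             ≡⟨ *-identityʳ r ⟩
    r                  ∎
    where
    r = x * y ⁻¹
    w = (c * y) ⁻¹
    r*y≡x : r * y ≡ x
    r*y≡x = begin-equality
      (x * y ⁻¹) * y  ≡⟨ *-assoc x (y ⁻¹) y ⟩
      x * (y ⁻¹ * y)  ≡⟨ cong (x *_) (*-comm (y ⁻¹) y) ⟩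
      x * (y * y ⁻¹)  ≡⟨ cong (x *_) (*-inverse y (0<x⇒x≢0 0<y)) ⟩
      x * 1#          ≡⟨ *-identityʳ x ⟩
      x               ∎

  fromℕ : ℕ → ℝ
  fromℕ zero = 0#
  fromℕ (suc m) = 1# + fromℕ m

  fromℕ-nonneg : ∀ m → 0# ≤ fromℕ m
  fromℕ-nonneg zero = ≤-refl
  fromℕ-nonneg (suc m) = ≤-trans (fromℕ-nonneg m) (x≤y+x (fromℕ m) (inj₁ 0<1))

  fromℕ-pos : ∀ {m} → 1 ℕ.≤ m → 0# < fromℕ m
  fromℕ-pos {suc m} _ = <-≤-trans 0<1 (subst (_≤ 1# + fromℕ m) (+-identityʳ 1#) (+-monoʳ-≤ 1# (fromℕ-nonneg m)))

module SumProperties (R : RealField) where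
  open RealField R
  open Program R using (sum; sumFrom)
  open OrderedFieldProperties R
  open AS.IsCommutativeRing isCommutativeRing using (+-assoc; +-identityˡ; *-identityˡ; distribˡ; distribʳ; zeroˡ; zeroʳ)

  sum-cong : ∀ n {f g : Fin n → ℝ} → (∀ i → f i ≡ g i) → sum n f ≡ sum n g
  sum-cong zero    f≗g = refl
  sum-cong (suc n) f≗g = cong₂ _+_ (f≗g zero) (sum-cong n (f≗g ∘ suc))

  sum-mono : ∀ n {f g : Fin n → ℝ} → (∀ i → f i ≤ g i) → sum n f ≤ sum n g
  sum-mono zero    f≤g = ≤-refl
  sum-mono (suc n) f≤g = +-mono-≤ (f≤g zero) (sum-mono n (f≤g ∘ suc))

  sum-+ : ∀ m n (f : Fin (m ℕ.+ n) → ℝ) → sum (m ℕ.+ n) f ≡ sum m (f ∘ (_↑ˡ n)) + sum n (f ∘ (m ↑ʳ_))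
  sum-+ zero    n f = sym (+-identityˡ (sum n f))
  sum-+ (suc m) n f = trans (cong (f zero +_) (sum-+ m n (f ∘ suc))) (sym (+-assoc _ _ _))

  sum-combine : ∀ k m (f : Fin (k ℕ.* m) → ℝ) → sum (k ℕ.* m) f ≡ sum k (λ i → sum m (λ j → f (combine i j)))
  sum-combine zero    m f = refl
  sum-combine (suc k) m f =
    trans (sum-+ m (k ℕ.* m) f) (cong (sum m (f ∘ (_↑ˡ k ℕ.* m)) +_) (sum-combine k m (f ∘ (m ↑ʳ_))))

  sum-const : ∀ m x → sum m (λ _ → x) ≡ fromℕ m * x
  sum-const zero    x = sym (zeroˡ x)
  sum-const (suc m) x = begin-equality
    x + sum m (λ _ → x)     ≡⟨ cong₂ _+_ (sym (*-identityˡ x)) (sum-const m x) ⟩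
    1# * x + fromℕ m * x    ≡⟨ distribʳ x 1# (fromℕ m) ⟨
    (1# + fromℕ m) * x      ∎

  *-distribˡ-sum : ∀ n c (f : Fin n → ℝ) → c * sum n f ≡ sum n (λ i → c * f i)
  *-distribˡ-sum zero    c f = zeroʳ c
  *-distribˡ-sum (suc n) c f = trans (distribˡ c (f zero) _) (cong (c * f zero +_) (*-distribˡ-sum n c (f ∘ suc)))

  sum-quotient : ∀ k m (f : Fin k → ℝ) → sum (k ℕ.* m) (f ∘ quotient {k} m) ≡ fromℕ m * sum k f
  sum-quotient k m f = begin-equality
    sum (k ℕ.* m) (f ∘ quotient m)                            ≡⟨ sum-combine k m _ ⟩
    sum k (λ i → sum m (λ j → f (quotient m (combine i j))))  ≡⟨ sum-cong k (λ i → sum-cong m λ j →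
                                                                   cong (f ∘ proj₁) (remQuot-combine i j)) ⟩
    sum k (λ i → sum m (λ _ → f i))                           ≡⟨ sum-cong k (λ i → sum-const m (f i)) ⟩
    sum k (λ i → fromℕ m * f i)                               ≡⟨ *-distribˡ-sum k (fromℕ m) f ⟨
    fromℕ m * sum k f                                         ∎

  restrictTo : {P : Set} → Dec P → ℝ → ℝ
  restrictTo (yes _) x = x
  restrictTo (no _)  _ = 0#

  restrictFrom : ∀ {n} → Fin n → (Fin n → ℝ) → Fin n → ℝ
  restrictFrom ℓ f i = restrictTo (toℕ ℓ ℕ.≤? toℕ i) (f i)

  -- The summand of sumFrom is bound in a where-block of Defs and cannot be
  -- named, so the left side of summand-restrictFrom is left to unification.
  mutual
    sumFrom-restrictFrom : ∀ {n} (ℓ : Fin n) f → sumFrom ℓ f ≡ sum n (restrictFrom ℓ f)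
    sumFrom-restrictFrom {n} ℓ f = sum-cong n (summand-restrictFrom ℓ f)

    summand-restrictFrom : ∀ {n} (ℓ : Fin n) f i → _ ≡ restrictFrom ℓ f i
    summand-restrictFrom ℓ f i with toℕ ℓ ℕ.≤? toℕ i
    ... | yes _ = refl
    ... | no _  = refl

  restrictFrom-quotient : ∀ {k} m (ℓ : Fin (k ℕ.* m)) (f : Fin k → ℝ) → (∀ i → 0# ≤ f i) →
    ∀ i → restrictFrom ℓ (f ∘ quotient m) i ≤ restrictFrom (quotient m ℓ) f (quotient m i)
  restrictFrom-quotient {k} m ℓ f f≥0 i with toℕ ℓ ℕ.≤? toℕ i | toℕ (quotient {k} m ℓ) ℕ.≤? toℕ (quotient {k} m i)
  ... | yes _   | yes _    = ≤-refl
  ... | yes ℓ≤i | no qℓ≰qi = contradiction (quotient-mono m ℓ≤i) qℓ≰qi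
  ... | no _    | yes _    = f≥0 (quotient m i)
  ... | no _    | no _     = ≤-refl

  sumFrom-quotient : ∀ {k} m (ℓ : Fin (k ℕ.* m)) (f : Fin k → ℝ) → (∀ i → 0# ≤ f i) →
    sumFrom ℓ (f ∘ quotient m) ≤ fromℕ m * sumFrom (quotient m ℓ) f
  sumFrom-quotient {k} m ℓ f f≥0 = begin
    sumFrom ℓ (f ∘ quotient m)                         ≡⟨ sumFrom-restrictFrom ℓ _ ⟩
    sum (k ℕ.* m) (restrictFrom ℓ (f ∘ quotient m))    ≤⟨ sum-mono (k ℕ.* m) (restrictFrom-quotient m ℓ f f≥0) ⟩
    sum (k ℕ.* m) (restrictFrom (quotient m ℓ) f ∘ quotient m) ≡⟨ sum-quotient k m _ ⟩
    fromℕ m * sum k (restrictFrom (quotient m ℓ) f)    ≡⟨ cong (fromℕ m *_) (sumFrom-restrictFrom (quotient m ℓ) f) ⟨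
    fromℕ m * sumFrom (quotient m ℓ) f                 ∎

module Repetition (R : RealField) where
  open RealField R
  open Program R
  open OrderedFieldProperties R
  open SumProperties R
  open AS.IsCommutativeRing isCommutativeRing using (*-assoc; *-comm; distribˡ)

  repeatPoint : ∀ {k} m → Point k → Point (k ℕ.* m)
  repeatPoint {k} m p = point (fromℕ m * F) (d ∘ quotient {k} m) (a ∘ quotient {k} m) (s ∘ quotient {k} m)
    where open Point p

  denominator-repeatPoint : ∀ {k} m (p : Point k) → denominator (repeatPoint m p) ≡ fromℕ m * denominator p
  denominator-repeatPoint {k} m p =
    trans (cong (fromℕ m * F +_) (sum-quotient k m (λ i → d i + ∣ a i ∣))) (sym (distribˡ (fromℕ m) F _))
    where open Point p

  numerator-repeatPoint : ∀ γ {k} m (p : Point k) → numerator γ (repeatPoint m p) ≡ fromℕ m * numerator γ p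
  numerator-repeatPoint γ {k} m p = begin-equality
    (1# + γ) * sum (k ℕ.* m) ((λ i → s i - a i) ∘ quotient m) ≡⟨ cong ((1# + γ) *_) (sum-quotient k m _) ⟩
    (1# + γ) * (fromℕ m * Σ)   ≡⟨ *-assoc (1# + γ) (fromℕ m) Σ ⟨
    ((1# + γ) * fromℕ m) * Σ   ≡⟨ cong (_* Σ) (*-comm (1# + γ) (fromℕ m)) ⟩
    (fromℕ m * (1# + γ)) * Σ   ≡⟨ *-assoc (fromℕ m) (1# + γ) Σ ⟩
    fromℕ m * ((1# + γ) * Σ)   ∎
    where
    open Point p
    Σ = sum k (λ i → s i - a i)

  objective-repeatPoint : ∀ γ {k m} (p : Point k) → 1 ℕ.≤ m → 0# < denominator p →
    objective γ (repeatPoint m p) ≡ objective γ p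
  objective-repeatPoint γ {m = m} p 1≤m 0<den =
    trans (cong₂ (λ x y → x * y ⁻¹) (numerator-repeatPoint γ m p) (denominator-repeatPoint m p))
          (*-cancelˡ-ratio (numerator γ p) (fromℕ-pos 1≤m) 0<den)

  repeatPoint-feasible : ∀ {γ k} m {p : Point k} → Feasible γ p → Feasible γ (repeatPoint m p)
  repeatPoint-feasible {γ} {k} m {p} feasible = record
    { s-mono   = λ i j j≡1+i → mono-from-steps s s-mono (quotient-mono m (subst (toℕ i ℕ.≤_) (sym j≡1+i) (ℕₚ.n≤1+n (toℕ i))))
    ; pair     = pair-repeated
    ; F-bound  = λ ℓ → ≤-trans (sumFrom-quotient m ℓ (tail ℓ) (λ i → y≤max[x,y] _ 0#))
                               (*-monoˡ-≤ _ _ (fromℕ-nonneg m) (F-bound (q ℓ)))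
    ; F-nonneg = x*y-nonneg (fromℕ-nonneg m) F-nonneg
    ; d-nonneg = d-nonneg ∘ q
    ; s≥a      = s≥a ∘ q
    }
    where
    open Point p
    open Feasible feasible
    q : Fin (k ℕ.* m) → Fin k
    q = quotient m
    tail : Fin (k ℕ.* m) → Fin k → ℝ
    tail ℓ i = max (γ * (s (q ℓ) - a i) - d i) 0#
    pair-repeated : ∀ i j → toℕ j ℕ.< toℕ i →
      (γ - 1#) * s (q i) - γ * a (q i) ≤ d (q i) + d (q j) + (γ - 1#) * s (q j) - γ * a (q j)
    pair-repeated i j j<i with q j Fin.≟ q i
    ... | yes qj≡qi rewrite qj≡qi =
      +-monoˡ-≤ _ (x≤y+x _ (x+y-nonneg (d-nonneg (q i)) (d-nonneg (q i))))
    ... | no qj≢qi = pair (q i) (q j) (≤∧≢⇒< (quotient-mono m (ℕₚ.<⇒≤ j<i)) qj≢qi)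

  repeatPoint-admissible : ∀ {γ k m} {p : Point k} → 1 ℕ.≤ m →
    Admissible γ k p → Admissible γ (k ℕ.* m) (repeatPoint m p)
  repeatPoint-admissible {m = m} {p} 1≤m (feasible , 0<den) =
    repeatPoint-feasible m feasible ,
    subst (0# <_) (sym (denominator-repeatPoint m p)) (*-pos _ _ (fromℕ-pos 1≤m) 0<den)

proposition8 : (R : RealField) → (γ : RealField.ℝ R) → RealField._<_ R (RealField.0# R) γ →
    (k m : ℕ) → k ℕ.≥ 1 → m ℕ.≥ 1 → Program.zLe R γ k (k ℕ.* m)
proposition8 R γ _ k m _ 1≤m p admissible ε 0<ε =
  repeatPoint m p ,
  repeatPoint-admissible 1≤m admissible ,
  subst (objective γ p - ε <_) (sym (objective-repeatPoint γ p 1≤m (proj₂ admissible))) (x-y<x _ 0<ε)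
  where
  open RealField R
  open Program R
  open OrderedFieldProperties R
  open Repetition R
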